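{- Let $m\ge1$, $S\subseteq[m]$, and let $(Y_1,\dots,Y_m)$ be as follows: $Y_i=2i$ if $i\notin S$, and $Y_i=i_0+i$ if $i\in S$, where $i_0$ is the largest $j<i$ with $j\notin S$ ($i_0=0$ if none exists). Let $T^M(S)\in YT((m,m),S)$ be the tableau with $y$-sequence $(Y_1,\dots,Y_m)$ (and $x$-sequence the increasing arrangement of $[2m]\setminus\{Y_1,\dots,Y_m\}$). Then the following three sets have the same cardinality: (1) the tableaux $T\in YT((m,m),S)$ whose $y$-sequence satisfies $Y_i\le y_i\le m+i$ for all $i$; (2) the lattice paths from $(0,0)$ to $(m,m)$ with steps $N,E$ that never go below $p(T^M(S))$; (3) the weakly increasing sequences $0\le\nu_1\le\dots\le\nu_m$ of integers with $\nu_i\le\mu_i(T^M(S))$ for all $i$.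
   Context: $YT((m,m),S)$ is the set of fillings of a $2\times m$ rectangle with $1,\dots,2m$, each used once, with one row $y_1<\dots<y_m$ and the other row $x_1<\dots<x_m$, such that $x_i<y_i$ for every $i\notin S$. For such $T$, $p(T)$ is the lattice path from $(0,0)$ to $(m,m)$ whose $j$-th step is $E=(1,0)$ if $j\in\{y_1,\dots,y_m\}$ and $N=(0,1)$ otherwise, and $\mu(T)=(\mu_1,\dots,\mu_m)$ with $\mu_i=x_i-i$ (the number of $E$ steps of $p(T)$ before its $i$-th $N$ step). -}

module Defs where

open import Data.Nat using (ℕ; zero; suc; _+_; _*_; _≤_; _<_)
open import Data.Bool using (Bool; true; false; if_then_else_)
open import Data.Fin as Fin using (Fin; toℕ)
open import Data.Fin.Subset using (Subset; _∈_; _∉_)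
open import Data.Vec using (Vec; []; _∷_; lookup; toList)
open import Data.List using (List; []; _∷_; map; take; length; upTo)
open import Data.List.Relation.Unary.Linked using (Linked)
open import Data.List.Relation.Binary.Pointwise using (Pointwise)
open import Data.Product using (_×_)
open import Relation.Binary.PropositionalEquality using (_≡_; _≢_)
open import Relation.Nullary using (¬_)
open import Data.Refinement using (Refinement-syntax)

-- Conventions.  [m] = {1,…,m}; the element i ∈ [m] is represented by
-- k : Fin m with i = toℕ k + 1.  S ⊆ [m] is a  Subset m  (Vec Bool m),
-- "i ∈ S" being  k ∈ S.  Sequences (z₁,…,z_m) are  Vec ℕ m , z_i = lookup z k.

ix : {m : ℕ} → Fin m → ℕ
ix k = suc (toℕ k)

-- Tableaux in YT((m,m),S): y-row and x-row, filled with 1..2m, each once.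

StrictlyIncreasing : {m : ℕ} → Vec ℕ m → Set
StrictlyIncreasing {m} z = (k l : Fin m) → k Fin.< l → lookup z k < lookup z l

IsYT : (m : ℕ) → Subset m → Vec ℕ m → Vec ℕ m → Set
IsYT m S y x =
    StrictlyIncreasing y
  × StrictlyIncreasing x
  × ((k : Fin m) → 1 ≤ lookup y k × lookup y k ≤ m + m)
  × ((k : Fin m) → 1 ≤ lookup x k × lookup x k ≤ m + m)
  -- no value used twice (the two rows are disjoint; within a row by strict increase);
  -- with 2m cells and values in {1,…,2m} this means each value is used exactly once
  × ((k l : Fin m) → lookup y k ≢ lookup x l)
  × ((k : Fin m) → k ∉ S → lookup x k < lookup y k)

YT : (m : ℕ) → Subset m → Set
YT m S = [ yx ∈ Vec ℕ m × Vec ℕ m ∣ IsYT m S (Data.Product.proj₁ yx) (Data.Product.proj₂ yx) ]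

-- YGo i l S' processes positions i, i+1, … ; l is the current i₀.

YGo : {n : ℕ} → ℕ → ℕ → Vec Bool n → Vec ℕ n
YGo i l []            = []
YGo i l (true  ∷ bs)  = (l + i) ∷ YGo (suc i) l bs
YGo i l (false ∷ bs)  = (2 * i) ∷ YGo (suc i) i bs

YM : (m : ℕ) → Subset m → Vec ℕ m
YM m S = YGo 1 0 S

data Step : Set where
  E N : Step

countE : List Step → ℕ
countE []       = 0
countE (E ∷ s)  = suc (countE s)
countE (N ∷ s)  = countE s

countN : List Step → ℕ
countN []       = 0
countN (N ∷ s)  = suc (countN s)
countN (E ∷ s)  = countN s

PathTo : ℕ → List Step → Set
PathTo m q = countE q ≡ m × countN q ≡ m

-- q never goes below p: after any number k of steps (i.e. on every
-- antidiagonal a+b = k), q has made at least as many N steps as p.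
NeverBelow : List Step → List Step → Set
NeverBelow q p = (k : ℕ) → countN (take k p) ≤ countN (take k q)

_∈ᵇ_ : ℕ → List ℕ → Bool
j ∈ᵇ []       = false
j ∈ᵇ (a ∷ as) = if j Data.Nat.≡ᵇ a then true else (j ∈ᵇ as)

pathOf : (m : ℕ) → Vec ℕ m → List Step
pathOf m y = map (λ j → if suc j ∈ᵇ toList y then E else N) (upTo (m + m))

muGo : ℕ → List Step → List ℕ
muGo c []       = []
muGo c (E ∷ s)  = muGo (suc c) s
muGo c (N ∷ s)  = c ∷ muGo c s

muOf : List Step → List ℕ
muOf = muGo 0

BoundedYT : (m : ℕ) → Subset m → Set
BoundedYT m S = [ yx ∈ Vec ℕ m × Vec ℕ m ∣
               IsYT m S (Data.Product.proj₁ yx) (Data.Product.proj₂ yx)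
             × ((k : Fin m) → lookup (YM m S) k ≤ lookup (Data.Product.proj₁ yx) k
                            × lookup (Data.Product.proj₁ yx) k ≤ m + ix k) ]

PathsAbove : (m : ℕ) → Subset m → Set
PathsAbove m S = [ q ∈ List Step ∣ PathTo m q × NeverBelow q (pathOf m (YM m S)) ]

NuSeqs : (m : ℕ) → Subset m → Set
NuSeqs m S = [ ν ∈ List ℕ ∣ length ν ≡ m × Linked _≤_ ν
                          × Pointwise _≤_ ν (muOf (pathOf m (YM m S))) ]

{-# OPTIONS --safe #-}

-- A tableau T is determined by its path p(T): the y-entries are the positions of the E steps and
-- the x-entries those of the N steps; a path is in turn determined by μ. For paths with the same
-- end point, "q never goes below p" compares prefix counts of N steps, and the Galois connection
-- between positions and prefix counts turns it into "the N positions of q are pointwise ≤ those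
-- of p", equivalently "the E positions of q are pointwise ≥ those of p", equivalently μ(q) ≤ μ(p).
-- So Y ≤ y says exactly that p(T) never goes below p(T^M(S)), and ν ≤ μ(T^M(S)) is the same
-- condition read through μ. The other tableau conditions hold for every path to (m,m): its i-th
-- E step is at position ≤ m + i, and if that position is ≥ 2i the i-th N step comes earlier, which
-- gives x_i < y_i for i ∉ S, where Y_i = 2i.

module Submission where

open import Defs
open import Data.Bool using (Bool; true; false; not; if_then_else_)
open import Data.Bool.Properties using (¬-not)
open import Data.Fin as Fin using (Fin; toℕ)
open import Data.Fin.Properties using (toℕ<n)
open import Data.Fin.Subset using (Subset; _∉_)
open import Data.Irrelevant using ([_])
open import Data.List using (List; []; _∷_; length; take; map; applyUpTo)
open import Data.List.Properties using (length-map; take-map; length-take; map-upTo)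
import Data.List.Properties as List
open import Data.List.Membership.Propositional using () renaming (_∈_ to _∈ₗ_; _∉_ to _∉ₗ_)
open import Data.List.Relation.Binary.Equality.Propositional using (≋⇒≡)
open import Data.List.Relation.Binary.Pointwise using (Pointwise; []; _∷_)
open import Data.List.Relation.Binary.Subset.Propositional using (_⊆_)
open import Data.List.Relation.Binary.Sublist.Propositional using (minimum; _∷ʳ_; ⊆-antisym)
  renaming (_⊆_ to _⊑_; _∷_ to _∷ₛ_)
open import Data.List.Relation.Binary.Sublist.Propositional.Properties using (length-mono-≤; to-≋)
open import Data.List.Relation.Unary.All as All using (All; []; _∷_)
open import Data.List.Relation.Unary.All.Properties using (All¬⇒¬Any)
open import Data.List.Relation.Unary.AllPairs using (AllPairs; []; _∷_)
open import Data.List.Relation.Unary.Any using (here; there)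
open import Data.List.Relation.Unary.Linked as Linked using (Linked; []; [-]; _∷_)
open import Data.Nat using (ℕ; zero; suc; _+_; _*_; _∸_; _⊓_; _≤_; _<_; z≤n; s≤s; _≟_; _≡ᵇ_)
open import Data.Nat.Properties
open import Data.List.Membership.DecPropositional _≟_ using (_∈?_)
open import Data.Product using (_×_; _,_; proj₁; proj₂)
open import Data.Product.Properties using () renaming (≡-dec to ×-≡-dec)
open import Data.Refinement using (Refinement-syntax; _,_; value-injective)
open import Data.Vec using (Vec; []; _∷_; lookup; toList) renaming (here to here[]; there to there[])
open import Data.Vec.Properties using (length-toList)
import Data.Vec.Properties as Vec
open import Function using (_∘_; _⇔_; mk⇔; Equivalence; _↔_; mk↔ₛ′)
open import Relation.Binary.Definitions using (DecidableEquality)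
open import Relation.Binary.PropositionalEquality
open import Relation.Nullary using (contradiction; yes; no; does)
open import Relation.Nullary.Decidable using (recompute)

open Equivalence using (to; from)

∈-tail : ∀ {v b bs} → v ∈ₗ b ∷ bs → b < v → v ∈ₗ bs
∈-tail (here refl) b<v = contradiction b<v (<-irrefl refl)
∈-tail (there v∈bs) _  = v∈bs

increasing-⊆⇒⊑ : ∀ {as bs} → AllPairs _<_ as → AllPairs _<_ bs → as ⊆ bs → as ⊑ bs
increasing-⊆⇒⊑ {[]}     _ _ _ = minimum _
increasing-⊆⇒⊑ {a ∷ as} {[]} _ _ as⊆bs with as⊆bs (here refl)
... | ()
increasing-⊆⇒⊑ {a ∷ as} {b ∷ bs} (a< ∷ as↗) (b< ∷ bs↗) as⊆bs with as⊆bs (here refl)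
... | here refl = refl ∷ₛ increasing-⊆⇒⊑ as↗ bs↗ λ v∈as → ∈-tail (as⊆bs (there v∈as)) (All.lookup a< v∈as)
... | there a∈bs = b ∷ʳ increasing-⊆⇒⊑ (a< ∷ as↗) bs↗ λ v∈as → ∈-tail (as⊆bs v∈as) (b<v v∈as)
  where
  b<v : ∀ {v} → v ∈ₗ a ∷ as → b < v
  b<v (here refl)  = All.lookup b< a∈bs
  b<v (there v∈as) = <-trans (All.lookup b< a∈bs) (All.lookup a< v∈as)

increasing-⊆-≥⇒≡ : ∀ {as bs} → AllPairs _<_ as → AllPairs _<_ bs →
                   as ⊆ bs → length bs ≤ length as → as ≡ bs
increasing-⊆-≥⇒≡ as↗ bs↗ as⊆bs |bs|≤|as| =
  ≋⇒≡ (to-≋ (≤-antisym (length-mono-≤ as⊑bs) |bs|≤|as|) as⊑bs)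
  where as⊑bs = increasing-⊆⇒⊑ as↗ bs↗ as⊆bs

increasing-⊆-⊇⇒≡ : ∀ {as bs} → AllPairs _<_ as → AllPairs _<_ bs → as ⊆ bs → bs ⊆ as → as ≡ bs
increasing-⊆-⊇⇒≡ as↗ bs↗ as⊆bs bs⊆as =
  ⊆-antisym (increasing-⊆⇒⊑ as↗ bs↗ as⊆bs) (increasing-⊆⇒⊑ bs↗ as↗ bs⊆as)

-- The i-th entry (from 0), with junk value 0 past the end.
nth : List ℕ → ℕ → ℕ
nth []      _       = 0
nth (a ∷ l) zero    = a
nth (a ∷ l) (suc i) = nth l i

All-nth : ∀ {P : ℕ → Set} {l i} → All P l → i < length l → P (nth l i)
All-nth {i = zero} (p ∷ _) _         = p
All-nth {i = suc i} (_ ∷ ps) (s≤s i<l) = All-nth ps i<l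

nth-∈ : ∀ {l i} → i < length l → nth l i ∈ₗ l
nth-∈ {_ ∷ _} {zero}  _         = here refl
nth-∈ {_ ∷ _} {suc i} (s≤s i<l) = there (nth-∈ i<l)

Pointwise-nth : ∀ {R : ℕ → ℕ → Set} {as bs i} → Pointwise R as bs → i < length as → R (nth as i) (nth bs i)
Pointwise-nth {i = zero} (r ∷ _) _         = r
Pointwise-nth {i = suc i} (_ ∷ rs) (s≤s i<l) = Pointwise-nth rs i<l

nth-Pointwise : ∀ {R : ℕ → ℕ → Set} as bs → length as ≡ length bs →
                (∀ i → i < length as → R (nth as i) (nth bs i)) → Pointwise R as bs
nth-Pointwise []       []       _     _ = []
nth-Pointwise (a ∷ as) (b ∷ bs) |as|≡ r =
  r zero (s≤s z≤n) ∷ nth-Pointwise as bs (suc-injective |as|≡) (λ i i< → r (suc i) (s≤s i<))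

Pointwise-≤-All : ∀ {M as bs} → Pointwise _≤_ as bs → All (_≤ M) bs → All (_≤ M) as
Pointwise-≤-All []       []         = []
Pointwise-≤-All (r ∷ rs) (b≤ ∷ bs≤) = ≤-trans r b≤ ∷ Pointwise-≤-All rs bs≤

0∷-Linked : ∀ {ν} → Linked _≤_ ν → Linked _≤_ (0 ∷ ν)
0∷-Linked []         = [-]
0∷-Linked [-]        = z≤n ∷ [-]
0∷-Linked (r ∷ ν↗)   = z≤n ∷ r ∷ ν↗

Linked-≤-head : ∀ {c d ν} → c ≤ d → Linked _≤_ (d ∷ ν) → Linked _≤_ (c ∷ ν)
Linked-≤-head c≤d [-]          = [-]
Linked-≤-head c≤d (d≤e ∷ d∷ν↗) = ≤-trans c≤d d≤e ∷ d∷ν↗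

≤-by-< : ∀ {a b} → (∀ i → i < a → i < b) → a ≤ b
≤-by-< {zero}  _ = z≤n
≤-by-< {suc a} f = f a ≤-refl

+-≡⇒≤⇔≥ : ∀ {a b c d} → a + b ≡ c + d → a ≤ c ⇔ d ≤ b
+-≡⇒≤⇔≥ {a} {b} {c} {d} eq = mk⇔
  (λ a≤c → +-cancelˡ-≤ a d b (≤-trans (+-monoˡ-≤ d a≤c) (≤-reflexive (sym eq))))
  (λ d≤b → +-cancelʳ-≤ d a c (≤-trans (+-monoʳ-≤ a d≤b) (≤-reflexive eq)))

∸-suc-≡ : ∀ {a c} → suc c ≤ a → a ∸ c ≡ suc (a ∸ suc c)
∸-suc-≡ (s≤s c≤a) = +-∸-assoc 1 c≤a

2*n≡n+n : ∀ n → 2 * n ≡ n + n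
2*n≡n+n n = cong (n +_) (+-identityʳ n)

InInterval : ℕ → ℕ → ℕ → Set
InInterval a b v = a < v × v ≤ b

InInterval-suc : ∀ {c n v} → InInterval (suc c) (suc c + n) v → InInterval c (c + suc n) v
InInterval-suc {c} {n} (c<v , v≤) = <-trans (n<1+n c) c<v , ≤-trans v≤ (≤-reflexive (sym (+-suc c n)))

IncreasingIn : ℕ → List ℕ → Set
IncreasingIn n l = AllPairs _<_ l × All (InInterval 0 n) l

-- Positions of the steps of a path

flip : Step → Step
flip E = N
flip N = E

countE-flip : ∀ q → countE (map flip q) ≡ countN q
countE-flip []      = refl
countE-flip (E ∷ q) = countE-flip q
countE-flip (N ∷ q) = cong suc (countE-flip q)

countE-take-flip : ∀ k q → countE (take k (map flip q)) ≡ countN (take k q)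
countE-take-flip k q = trans (cong countE (take-map k q)) (countE-flip (take k q))

countE+countN : ∀ q → countE q + countN q ≡ length q
countE+countN []      = refl
countE+countN (E ∷ q) = cong suc (countE+countN q)
countE+countN (N ∷ q) = trans (+-suc (countE q) (countN q)) (cong suc (countE+countN q))

countE+countN-take : ∀ k q → countE (take k q) + countN (take k q) ≡ k ⊓ length q
countE+countN-take k q = trans (countE+countN (take k q)) (length-take k q)

countE-take-≤ : ∀ k q → countE (take k q) ≤ countE q
countE-take-≤ zero    q       = z≤n
countE-take-≤ (suc k) []      = z≤n
countE-take-≤ (suc k) (E ∷ q) = s≤s (countE-take-≤ k q)
countE-take-≤ (suc k) (N ∷ q) = countE-take-≤ k q

countN-take-≤ : ∀ k q → countN (take k q) ≤ countN q
countN-take-≤ k q = subst₂ _≤_ (countE-take-flip k q) (countE-flip q) (countE-take-≤ k (map flip q))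

-- Positions of the E steps of q when its steps are numbered c + 1, c + 2, …
ePositions : ℕ → List Step → List ℕ
ePositions c []      = []
ePositions c (E ∷ q) = suc c ∷ ePositions (suc c) q
ePositions c (N ∷ q) = ePositions (suc c) q

nPositions : ℕ → List Step → List ℕ
nPositions c q = ePositions c (map flip q)

length-ePositions : ∀ c q → length (ePositions c q) ≡ countE q
length-ePositions c []      = refl
length-ePositions c (E ∷ q) = cong suc (length-ePositions (suc c) q)
length-ePositions c (N ∷ q) = length-ePositions (suc c) q

length-nPositions : ∀ c q → length (nPositions c q) ≡ countN q
length-nPositions c q = trans (length-ePositions c (map flip q)) (countE-flip q)

ePositions-bounded : ∀ c q → All (InInterval c (c + length q)) (ePositions c q)
ePositions-bounded c []      = []
ePositions-bounded c (E ∷ q) =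
  (n<1+n c , ≤-trans (s≤s (m≤m+n c _)) (≤-reflexive (sym (+-suc c _)))) ∷
  All.map InInterval-suc (ePositions-bounded (suc c) q)
ePositions-bounded c (N ∷ q) = All.map InInterval-suc (ePositions-bounded (suc c) q)

ePositions-> : ∀ c q {v} → v ∈ₗ ePositions c q → c < v
ePositions-> c q = proj₁ ∘ All.lookup (ePositions-bounded c q)

ePositions-increasing : ∀ c q → AllPairs _<_ (ePositions c q)
ePositions-increasing c []      = []
ePositions-increasing c (E ∷ q) = All.map proj₁ (ePositions-bounded (suc c) q) ∷ ePositions-increasing (suc c) q
ePositions-increasing c (N ∷ q) = ePositions-increasing (suc c) q

ePositions-increasingIn : ∀ q → IncreasingIn (length q) (ePositions 0 q)
ePositions-increasingIn q = ePositions-increasing 0 q , ePositions-bounded 0 q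

nPositions-increasingIn : ∀ q → IncreasingIn (length q) (nPositions 0 q)
nPositions-increasingIn q =
  subst (λ n → IncreasingIn n (nPositions 0 q)) (length-map flip q) (ePositions-increasingIn (map flip q))

ePositions-nPositions-disjoint : ∀ c q {v} → v ∈ₗ ePositions c q → v ∉ₗ nPositions c q
ePositions-nPositions-disjoint c (E ∷ q) (here refl) v∈N = <-irrefl refl (ePositions-> (suc c) (map flip q) v∈N)
ePositions-nPositions-disjoint c (E ∷ q) (there v∈E) v∈N = ePositions-nPositions-disjoint (suc c) q v∈E v∈N
ePositions-nPositions-disjoint c (N ∷ q) v∈E (here refl) = <-irrefl refl (ePositions-> (suc c) q v∈E)
ePositions-nPositions-disjoint c (N ∷ q) v∈E (there v∈N) = ePositions-nPositions-disjoint (suc c) q v∈E v∈N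

nth-ePositions-bounded : ∀ c q {i} → i < countE q → InInterval c (c + length q) (nth (ePositions c q) i)
nth-ePositions-bounded c q i<q = All-nth (ePositions-bounded c q) (subst (_ <_) (sym (length-ePositions c q)) i<q)

ePositions-≤⇔ : ∀ c q i k → i < countE q → nth (ePositions c q) i ≤ c + k ⇔ i < countE (take k q)
ePositions-≤⇔ c q i zero i<q =
  mk⇔ (λ h → contradiction (≤-trans h (≤-reflexive (+-identityʳ c))) (<⇒≱ (proj₁ (nth-ePositions-bounded c q i<q))))
      (λ ())
ePositions-≤⇔ c []      i       (suc k) ()
ePositions-≤⇔ c (E ∷ q) zero    (suc k) _ rewrite +-suc c k = mk⇔ (λ _ → s≤s z≤n) (λ _ → s≤s (m≤m+n c k))
ePositions-≤⇔ c (E ∷ q) (suc i) (suc k) (s≤s i<q) rewrite +-suc c k = mk⇔ (s≤s ∘ to ih) (from ih ∘ ≤-pred)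
  where ih = ePositions-≤⇔ (suc c) q i k i<q
ePositions-≤⇔ c (N ∷ q) i       (suc k) i<q rewrite +-suc c k = ePositions-≤⇔ (suc c) q i k i<q

nPositions-≤⇔ : ∀ c q i k → i < countN q → nth (nPositions c q) i ≤ c + k ⇔ i < countN (take k q)
nPositions-≤⇔ c q i k i<q =
  subst (λ z → nth (nPositions c q) i ≤ c + k ⇔ i < z) (countE-take-flip k q)
        (ePositions-≤⇔ c (map flip q) i k (subst (i <_) (sym (countE-flip q)) i<q))

ePositions-≤⇔dominated : ∀ q p → countE q ≡ countE p →
  Pointwise _≤_ (ePositions 0 q) (ePositions 0 p) ⇔ (∀ k → countE (take k p) ≤ countE (take k q))
ePositions-≤⇔dominated q p |q|≡|p| = mk⇔ dominated positions-≤
  where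
  i<q : ∀ {i} → i < countE p → i < countE q
  i<q = subst (_ <_) (sym |q|≡|p|)
  dominated : Pointwise _≤_ (ePositions 0 q) (ePositions 0 p) → ∀ k → countE (take k p) ≤ countE (take k q)
  dominated q≤p k = ≤-by-< λ i i<pk →
    let i<p = <-≤-trans i<pk (countE-take-≤ k p) in
    to (ePositions-≤⇔ 0 q i k (i<q i<p))
       (≤-trans (Pointwise-nth q≤p (subst (i <_) (sym (length-ePositions 0 q)) (i<q i<p)))
                (from (ePositions-≤⇔ 0 p i k i<p) i<pk))
  positions-≤ : (∀ k → countE (take k p) ≤ countE (take k q)) → Pointwise _≤_ (ePositions 0 q) (ePositions 0 p)
  positions-≤ dom =
    nth-Pointwise _ _ (trans (length-ePositions 0 q) (trans |q|≡|p| (sym (length-ePositions 0 p)))) λ i i<l →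
      let i<q′ = subst (i <_) (length-ePositions 0 q) i<l
          k = nth (ePositions 0 p) i in
      from (ePositions-≤⇔ 0 q i k i<q′)
           (<-≤-trans (to (ePositions-≤⇔ 0 p i k (subst (i <_) |q|≡|p| i<q′)) ≤-refl) (dom k))

nPositions-≤⇔NeverBelow : ∀ q p → countN q ≡ countN p →
  Pointwise _≤_ (nPositions 0 q) (nPositions 0 p) ⇔ NeverBelow q p
nPositions-≤⇔NeverBelow q p |q|≡|p| = mk⇔
  (λ q≤p k → subst₂ _≤_ (countE-take-flip k p) (countE-take-flip k q) (to flipped q≤p k))
  (λ q≥p → from flipped λ k → subst₂ _≤_ (sym (countE-take-flip k p)) (sym (countE-take-flip k q)) (q≥p k))
  where flipped = ePositions-≤⇔dominated (map flip q) (map flip p)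
                    (trans (countE-flip q) (trans |q|≡|p| (sym (countE-flip p))))

ePositions-≥⇔NeverBelow : ∀ q p → countE q ≡ countE p → length q ≡ length p →
  Pointwise _≤_ (ePositions 0 p) (ePositions 0 q) ⇔ NeverBelow q p
ePositions-≥⇔NeverBelow q p |q|≡|p| len = mk⇔
  (λ p≤q k → to (complement k) (to dominated p≤q k))
  (λ q≥p → from dominated λ k → from (complement k) (q≥p k))
  where
  dominated = ePositions-≤⇔dominated p q (sym |q|≡|p|)
  complement : ∀ k → countE (take k q) ≤ countE (take k p) ⇔ countN (take k p) ≤ countN (take k q)
  complement k = +-≡⇒≤⇔≥ (trans (countE+countN-take k q) (trans (cong (k ⊓_) len) (sym (countE+countN-take k p))))

-- Before the i-th E step (from 0) there are i E steps and at most countN q N steps.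
nth-ePositions-≤ : ∀ q {i} → i < countE q → nth (ePositions 0 q) i ≤ countN q + suc i
nth-ePositions-≤ q {i} i<E = from (ePositions-≤⇔ 0 q i k i<E) (from (+-≡⇒≤⇔≥ counts) (countN-take-≤ k q))
  where
  k = countN q + suc i
  k≤len : k ≤ length q
  k≤len = ≤-trans (+-monoʳ-≤ (countN q) i<E) (≤-reflexive (trans (+-comm (countN q) _) (countE+countN q)))
  counts : suc i + countN q ≡ countE (take k q) + countN (take k q)
  counts = trans (+-comm (suc i) _) (trans (sym (m≤n⇒m⊓n≡m k≤len)) (sym (countE+countN-take k q)))

-- If the i-th E step (from 0) is at position j + 1 ≥ 2i + 2, then among the first j steps
-- at most i are E steps, hence at least i + 1 are N steps.
nth-nPositions-< : ∀ q {i} → i < countE q → i < countN q → 2 * suc i ≤ nth (ePositions 0 q) i →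
                   nth (nPositions 0 q) i < nth (ePositions 0 q) i
nth-nPositions-< q {i} i<E i<N 2i+2≤e
  with nth (ePositions 0 q) i | ePositions-≤⇔ 0 q i | nth-ePositions-bounded 0 q i<E
... | suc j | gal | (_ , e≤len) = s≤s (from (nPositions-≤⇔ 0 q i j i<N) i<Nⱼ)
  where
  Eⱼ≤i : countE (take j q) ≤ i
  Eⱼ≤i = ≮⇒≥ λ i<Eⱼ → <-irrefl refl (from (gal j i<E) i<Eⱼ)
  counts : countE (take j q) + countN (take j q) ≡ j
  counts = trans (countE+countN-take j q) (m≤n⇒m⊓n≡m (<⇒≤ e≤len))
  2i+1≤j : suc i + i ≤ j
  2i+1≤j = ≤-pred (subst (_≤ suc j) (trans (2*n≡n+n (suc i)) (+-suc (suc i) i)) 2i+2≤e)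
  i<Nⱼ : i < countN (take j q)
  i<Nⱼ = +-cancelˡ-≤ i _ _ (begin
    i + suc i                          ≡⟨ +-comm i (suc i) ⟩
    suc i + i                          ≤⟨ 2i+1≤j ⟩
    j                                  ≡⟨ sym counts ⟩
    countE (take j q) + countN (take j q) ≤⟨ +-monoˡ-≤ _ Eⱼ≤i ⟩
    i + countN (take j q)              ∎)
    where open ≤-Reasoning

-- Paths with prescribed E positions

steps : (ℕ → Bool) → ℕ → ℕ → List Step
steps P c zero    = []
steps P c (suc n) = (if P (suc c) then E else N) ∷ steps P (suc c) n

length-steps : ∀ P c n → length (steps P c n) ≡ n
length-steps P c zero    = refl
length-steps P c (suc n) = cong suc (length-steps P (suc c) n)

applyUpTo-steps : ∀ P c n (f : ℕ → Step) → (∀ j → f j ≡ (if P (suc (c + j)) then E else N)) →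
                  applyUpTo f n ≡ steps P c n
applyUpTo-steps P c zero    f f≗ = refl
applyUpTo-steps P c (suc n) f f≗ = cong₂ _∷_
  (trans (f≗ 0) (cong (λ z → if P (suc z) then E else N) (+-identityʳ c)))
  (applyUpTo-steps P (suc c) n (f ∘ suc) λ j → trans (f≗ (suc j)) (cong (λ z → if P (suc z) then E else N) (+-suc c j)))

pathOf-steps : ∀ m y → pathOf m y ≡ steps (_∈ᵇ toList y) 0 (m + m)
pathOf-steps m y = trans (map-upTo _ (m + m)) (applyUpTo-steps _ 0 (m + m) _ λ _ → refl)

map-flip-steps : ∀ P c n → map flip (steps P c n) ≡ steps (not ∘ P) c n
map-flip-steps P c zero = refl
map-flip-steps P c (suc n) with P (suc c)
... | true  = cong (N ∷_) (map-flip-steps P (suc c) n)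
... | false = cong (E ∷_) (map-flip-steps P (suc c) n)

∈-ePositions-steps⁻ : ∀ P c n {v} → v ∈ₗ ePositions c (steps P c n) → P v ≡ true
∈-ePositions-steps⁻ P c (suc n) v∈ with P (suc c) in eq | v∈
... | true  | here refl = eq
... | true  | there v∈′ = ∈-ePositions-steps⁻ P (suc c) n v∈′
... | false | v∈′       = ∈-ePositions-steps⁻ P (suc c) n v∈′

∈-ePositions-steps⁺ : ∀ P c n {v} → InInterval c (c + n) v → P v ≡ true → v ∈ₗ ePositions c (steps P c n)
∈-ePositions-steps⁺ P c zero (c<v , v≤) _ = contradiction (≤-trans v≤ (≤-reflexive (+-identityʳ c))) (<⇒≱ c<v)
∈-ePositions-steps⁺ P c (suc n) {v} (c<v , v≤) Pv with v ≟ suc c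
... | yes refl rewrite Pv = here refl
... | no v≢ with P (suc c) | ∈-ePositions-steps⁺ P (suc c) n (≤∧≢⇒< c<v (v≢ ∘ sym) , ≤-trans v≤ (≤-reflexive (+-suc c n))) Pv
...   | true  | v∈ = there v∈
...   | false | v∈ = v∈

∈-nPositions-steps⁺ : ∀ P c n {v} → InInterval c (c + n) v → P v ≡ false → v ∈ₗ nPositions c (steps P c n)
∈-nPositions-steps⁺ P c n v∈ Pv rewrite map-flip-steps P c n = ∈-ePositions-steps⁺ (not ∘ P) c n v∈ (cong not Pv)

steps-ePositions : ∀ P c q → (∀ {v} → c < v → P v ≡ true ⇔ v ∈ₗ ePositions c q) → steps P c (length q) ≡ q
steps-ePositions P c []      _  = refl
steps-ePositions P c (E ∷ q) P⇔ with P (suc c) in eq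
... | true  = cong (E ∷_) (steps-ePositions P (suc c) q P⇔′)
  where
  P⇔′ : ∀ {v} → suc c < v → P v ≡ true ⇔ v ∈ₗ ePositions (suc c) q
  P⇔′ c<v = let P⇔v = P⇔ (<-trans (n<1+n c) c<v) in mk⇔ (λ Pv → ∈-tail (to P⇔v Pv) c<v) (from P⇔v ∘ there)
... | false = contradiction (trans (sym eq) (from (P⇔ (n<1+n c)) (here refl))) λ ()
steps-ePositions P c (N ∷ q) P⇔ with P (suc c) in eq
... | true  = contradiction (ePositions-> (suc c) q (to (P⇔ (n<1+n c)) eq)) (<-irrefl refl)
... | false = cong (N ∷_) (steps-ePositions P (suc c) q λ c<v → P⇔ (<-trans (n<1+n c) c<v))

∈ᵇ≡does : ∀ v l → v ∈ᵇ l ≡ does (v ∈? l)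
∈ᵇ≡does v []      = refl
∈ᵇ≡does v (a ∷ l) with v ≡ᵇ a
... | true  = refl
... | false = ∈ᵇ≡does v l

∈ᵇ⇔∈ : ∀ {v} l → v ∈ᵇ l ≡ true ⇔ v ∈ₗ l
∈ᵇ⇔∈ {v} l rewrite ∈ᵇ≡does v l with v ∈? l
... | yes v∈l = mk⇔ (λ _ → v∈l) (λ _ → refl)
... | no  v∉l = mk⇔ (λ ()) (λ v∈l → contradiction v∈l v∉l)

ePositions-steps-∈ᵇ : ∀ n l → IncreasingIn n l → ePositions 0 (steps (_∈ᵇ l) 0 n) ≡ l
ePositions-steps-∈ᵇ n l (l↗ , l⊆[1,n]) = increasing-⊆-⊇⇒≡ (ePositions-increasing 0 (steps (_∈ᵇ l) 0 n)) l↗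
  (λ v∈ → to (∈ᵇ⇔∈ l) (∈-ePositions-steps⁻ _ 0 n v∈))
  (λ v∈l → ∈-ePositions-steps⁺ _ 0 n (All.lookup l⊆[1,n] v∈l) (from (∈ᵇ⇔∈ l) v∈l))

countE-steps-∈ᵇ : ∀ n l → IncreasingIn n l → countE (steps (_∈ᵇ l) 0 n) ≡ length l
countE-steps-∈ᵇ n l l↗ =
  trans (sym (length-ePositions 0 (steps (_∈ᵇ l) 0 n))) (cong length (ePositions-steps-∈ᵇ n l l↗))

-- l′ lies in the complement of l, which has the same length.
nPositions-steps-∈ᵇ : ∀ n l l′ → IncreasingIn n l → IncreasingIn n l′ → All (_∉ₗ l) l′ →
                      length l + length l′ ≡ n → nPositions 0 (steps (_∈ᵇ l) 0 n) ≡ l′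
nPositions-steps-∈ᵇ n l l′ l↗ (l′↗ , l′⊆[1,n]) l′∉l |l|+|l′|≡n =
  sym (increasing-⊆-≥⇒≡ l′↗ (ePositions-increasing 0 (map flip q)) l′⊆ (≤-reflexive |N|≡|l′|))
  where
  q = steps (_∈ᵇ l) 0 n
  l′⊆ : l′ ⊆ nPositions 0 q
  l′⊆ v∈ = ∈-nPositions-steps⁺ _ 0 n (All.lookup l′⊆[1,n] v∈) (¬-not (All.lookup l′∉l v∈ ∘ to (∈ᵇ⇔∈ l)))
  |N|≡|l′| : length (nPositions 0 q) ≡ length l′
  |N|≡|l′| = +-cancelˡ-≡ (length l) _ _ (begin
    length l + length (nPositions 0 q) ≡⟨ cong₂ _+_ (sym (countE-steps-∈ᵇ n l l↗)) (length-nPositions 0 q) ⟩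
    countE q + countN q                ≡⟨ countE+countN q ⟩
    length q                           ≡⟨ length-steps _ 0 n ⟩
    n                                  ≡⟨ sym |l|+|l′|≡n ⟩
    length l + length l′               ∎)
    where open ≡-Reasoning

-- The sequence μ

addIndex : ℕ → List ℕ → List ℕ
addIndex t []       = []
addIndex t (a ∷ as) = a + t ∷ addIndex (suc t) as

addIndex-≤⁺ : ∀ t {as bs} → Pointwise _≤_ as bs → Pointwise _≤_ (addIndex t as) (addIndex t bs)
addIndex-≤⁺ t []       = []
addIndex-≤⁺ t (r ∷ rs) = +-monoˡ-≤ t r ∷ addIndex-≤⁺ (suc t) rs

addIndex-≤⁻ : ∀ t {as bs} → Pointwise _≤_ (addIndex t as) (addIndex t bs) → Pointwise _≤_ as bs
addIndex-≤⁻ t {[]}     {[]}     []       = []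
addIndex-≤⁻ t {a ∷ as} {b ∷ bs} (r ∷ rs) = +-cancelʳ-≤ t a b r ∷ addIndex-≤⁻ (suc t) rs

-- The i-th N step is preceded by μᵢ E steps and i N steps.
nPositions-muGo : ∀ c t q → nPositions (c + t) q ≡ addIndex (suc t) (muGo c q)
nPositions-muGo c t []      = refl
nPositions-muGo c t (E ∷ q) = nPositions-muGo (suc c) t q
nPositions-muGo c t (N ∷ q) rewrite sym (+-suc c t) = cong (c + suc t ∷_) (nPositions-muGo c (suc t) q)

muOf-≤⇔NeverBelow : ∀ q p → countN q ≡ countN p → Pointwise _≤_ (muOf q) (muOf p) ⇔ NeverBelow q p
muOf-≤⇔NeverBelow q p |q|≡|p| = mk⇔
  (to nPositions-≤ ∘ subst₂ (Pointwise _≤_) (sym (nPositions-muGo 0 0 q)) (sym (nPositions-muGo 0 0 p))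
                   ∘ addIndex-≤⁺ 1)
  (addIndex-≤⁻ 1 ∘ subst₂ (Pointwise _≤_) (nPositions-muGo 0 0 q) (nPositions-muGo 0 0 p)
                 ∘ from nPositions-≤)
  where nPositions-≤ = nPositions-≤⇔NeverBelow q p |q|≡|p|

length-muGo : ∀ c q → length (muGo c q) ≡ countN q
length-muGo c []      = refl
length-muGo c (E ∷ q) = length-muGo (suc c) q
length-muGo c (N ∷ q) = cong suc (length-muGo c q)

muGo-linked : ∀ c q → Linked _≤_ (c ∷ muGo c q)
muGo-linked c []      = [-]
muGo-linked c (E ∷ q) = Linked-≤-head (n≤1+n c) (muGo-linked (suc c) q)
muGo-linked c (N ∷ q) = ≤-refl ∷ muGo-linked c q

muGo-≤ : ∀ c q → All (_≤ c + countE q) (muGo c q)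
muGo-≤ c []      = []
muGo-≤ c (E ∷ q) = All.map (λ h → ≤-trans h (≤-reflexive (sym (+-suc c _)))) (muGo-≤ (suc c) q)
muGo-≤ c (N ∷ q) = m≤m+n c _ ∷ muGo-≤ c q

prependEs : ℕ → List Step → List Step
prependEs zero    q = q
prependEs (suc k) q = E ∷ prependEs k q

pathWithMu : ℕ → ℕ → List ℕ → List Step
pathWithMu m c []      = prependEs (m ∸ c) []
pathWithMu m c (a ∷ ν) = prependEs (a ∸ c) (N ∷ pathWithMu m a ν)

muGo-prependEs : ∀ k c q → muGo c (prependEs k q) ≡ muGo (k + c) q
muGo-prependEs zero    c q = refl
muGo-prependEs (suc k) c q = trans (muGo-prependEs k (suc c) q) (cong (λ z → muGo z q) (+-suc k c))

countE-prependEs : ∀ k q → countE (prependEs k q) ≡ k + countE q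
countE-prependEs zero    q = refl
countE-prependEs (suc k) q = cong suc (countE-prependEs k q)

countN-prependEs : ∀ k q → countN (prependEs k q) ≡ countN q
countN-prependEs zero    q = refl
countN-prependEs (suc k) q = countN-prependEs k q

muGo-pathWithMu : ∀ m c ν → Linked _≤_ (c ∷ ν) → muGo c (pathWithMu m c ν) ≡ ν
muGo-pathWithMu m c []      _           = muGo-prependEs (m ∸ c) c []
muGo-pathWithMu m c (a ∷ ν) (c≤a ∷ a∷ν↗) = begin
  muGo c (prependEs (a ∸ c) (N ∷ pathWithMu m a ν)) ≡⟨ muGo-prependEs (a ∸ c) c _ ⟩
  muGo (a ∸ c + c) (N ∷ pathWithMu m a ν)           ≡⟨ cong (λ z → muGo z (N ∷ pathWithMu m a ν)) (m∸n+n≡m c≤a) ⟩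
  a ∷ muGo a (pathWithMu m a ν)                     ≡⟨ cong (a ∷_) (muGo-pathWithMu m a ν a∷ν↗) ⟩
  a ∷ ν                                             ∎
  where open ≡-Reasoning

pathWithMu-suc : ∀ m c ν → suc c ≤ m → Linked _≤_ (suc c ∷ ν) → pathWithMu m c ν ≡ E ∷ pathWithMu m (suc c) ν
pathWithMu-suc m c []      c<m _           = cong (λ k → prependEs k []) (∸-suc-≡ c<m)
pathWithMu-suc m c (a ∷ ν) _   (c<a ∷ _)   = cong (λ k → prependEs k (N ∷ pathWithMu m a ν)) (∸-suc-≡ c<a)

pathWithMu-muGo : ∀ m c q → c + countE q ≡ m → pathWithMu m c (muGo c q) ≡ q
pathWithMu-muGo m c []      refl = cong (λ k → prependEs k []) (trans (cong (_∸ c) (+-identityʳ c)) (n∸n≡0 c))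
pathWithMu-muGo m c (N ∷ q) eq   rewrite n∸n≡0 c = cong (N ∷_) (pathWithMu-muGo m c q eq)
pathWithMu-muGo m c (E ∷ q) eq   = begin
  pathWithMu m c (muGo (suc c) q)           ≡⟨ pathWithMu-suc m c _ c<m (muGo-linked (suc c) q) ⟩
  E ∷ pathWithMu m (suc c) (muGo (suc c) q) ≡⟨ cong (E ∷_) (pathWithMu-muGo m (suc c) q eq′) ⟩
  E ∷ q                                     ∎
  where
  open ≡-Reasoning
  eq′ : suc c + countE q ≡ m
  eq′ = trans (sym (+-suc c (countE q))) eq
  c<m : suc c ≤ m
  c<m = subst (suc c ≤_) eq′ (m≤m+n (suc c) (countE q))

countE-pathWithMu : ∀ m c ν → c ≤ m → Linked _≤_ (c ∷ ν) → All (_≤ m) ν → c + countE (pathWithMu m c ν) ≡ m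
countE-pathWithMu m c []      c≤m _            _           =
  trans (cong (c +_) (trans (countE-prependEs (m ∸ c) []) (+-identityʳ _))) (m+[n∸m]≡n c≤m)
countE-pathWithMu m c (a ∷ ν) _   (c≤a ∷ a∷ν↗) (a≤m ∷ ν≤m) = begin
  c + countE (prependEs (a ∸ c) (N ∷ pathWithMu m a ν)) ≡⟨ cong (c +_) (countE-prependEs (a ∸ c) _) ⟩
  c + (a ∸ c + countE (pathWithMu m a ν))              ≡⟨ sym (+-assoc c (a ∸ c) _) ⟩
  c + (a ∸ c) + countE (pathWithMu m a ν)              ≡⟨ cong (_+ countE (pathWithMu m a ν)) (m+[n∸m]≡n c≤a) ⟩
  a + countE (pathWithMu m a ν)                        ≡⟨ countE-pathWithMu m a ν a≤m a∷ν↗ ν≤m ⟩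
  m                                                    ∎
  where open ≡-Reasoning

countN-pathWithMu : ∀ m c ν → countN (pathWithMu m c ν) ≡ length ν
countN-pathWithMu m c []      = countN-prependEs (m ∸ c) []
countN-pathWithMu m c (a ∷ ν) = trans (countN-prependEs (a ∸ c) _) (cong suc (countN-pathWithMu m a ν))

_≟ₛ_ : DecidableEquality Step
E ≟ₛ E = yes refl
E ≟ₛ N = no λ ()
N ≟ₛ E = no λ ()
N ≟ₛ N = yes refl

IsPathAbove : ℕ → List Step → List Step → Set
IsPathAbove m p q = PathTo m q × NeverBelow q p

IsSeqBelow : ℕ → List ℕ → List ℕ → Set
IsSeqBelow m μ ν = length ν ≡ m × Linked _≤_ ν × Pointwise _≤_ ν μ

module _ {m p} (p-path : PathTo m p) where

  muOf-isSeqBelow : ∀ q → IsPathAbove m p q → IsSeqBelow m (muOf p) (muOf q)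
  muOf-isSeqBelow q ((_ , qN) , q≥p) =
    trans (length-muGo 0 q) qN , Linked.tail (muGo-linked 0 q) ,
    from (muOf-≤⇔NeverBelow q p (trans qN (sym (proj₂ p-path)))) q≥p

  pathWithMu-isPathAbove : ∀ ν → IsSeqBelow m (muOf p) ν → IsPathAbove m p (pathWithMu m 0 ν)
  pathWithMu-isPathAbove ν (|ν|≡m , ν↗ , ν≤μ) =
    (qE , qN) , to (muOf-≤⇔NeverBelow q p (trans qN (sym (proj₂ p-path)))) q≤μ
    where
    q = pathWithMu m 0 ν
    μ≤m : All (_≤ m) (muOf p)
    μ≤m = subst (λ M → All (_≤ M) (muOf p)) (proj₁ p-path) (muGo-≤ 0 p)
    qE = countE-pathWithMu m 0 ν z≤n (0∷-Linked ν↗) (Pointwise-≤-All ν≤μ μ≤m)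
    qN = trans (countN-pathWithMu m 0 ν) |ν|≡m
    q≤μ = subst (λ μ → Pointwise _≤_ μ (muOf p)) (sym (muGo-pathWithMu m 0 ν (0∷-Linked ν↗))) ν≤μ

  pathsAbove↔seqsBelowMu : [ q ∈ List Step ∣ IsPathAbove m p q ] ↔ [ ν ∈ List ℕ ∣ IsSeqBelow m (muOf p) ν ]
  pathsAbove↔seqsBelowMu = mk↔ₛ′
    (λ { (q , [ q-above ]) → muOf q , [ muOf-isSeqBelow q q-above ] })
    (λ { (ν , [ ν-below ]) → pathWithMu m 0 ν , [ pathWithMu-isPathAbove ν ν-below ] })
    (λ { (ν , [ ν-below ]) → value-injective
           (recompute (List.≡-dec _≟_ _ ν) (muGo-pathWithMu m 0 ν (0∷-Linked (proj₁ (proj₂ ν-below))))) })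
    (λ { (q , [ q-above ]) → value-injective
           (recompute (List.≡-dec _≟ₛ_ _ q) (pathWithMu-muGo m 0 q (proj₁ (proj₁ q-above)))) })

-- Pads with 0 or truncates, so that lookup agrees with nth unconditionally.
toVec : (n : ℕ) → List ℕ → Vec ℕ n
toVec zero    _       = []
toVec (suc n) []      = 0 ∷ toVec n []
toVec (suc n) (a ∷ l) = a ∷ toVec n l

toList-toVec : ∀ n l → length l ≡ n → toList (toVec n l) ≡ l
toList-toVec zero    []      _     = refl
toList-toVec (suc n) (a ∷ l) |l|≡n = cong (a ∷_) (toList-toVec n l (suc-injective |l|≡n))

toVec-toList : ∀ {n} (v : Vec ℕ n) → toVec n (toList v) ≡ v
toVec-toList []      = refl
toVec-toList (a ∷ v) = cong (a ∷_) (toVec-toList v)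

lookup-toVec : ∀ n l (k : Fin n) → lookup (toVec n l) k ≡ nth l (toℕ k)
lookup-toVec (suc n) []      Fin.zero    = refl
lookup-toVec (suc n) (a ∷ l) Fin.zero    = refl
lookup-toVec (suc n) []      (Fin.suc k) = lookup-toVec n [] k
lookup-toVec (suc n) (a ∷ l) (Fin.suc k) = lookup-toVec n l k

lookup-toVec-∈ : ∀ {n l} → length l ≡ n → ∀ k → lookup (toVec n l) k ∈ₗ l
lookup-toVec-∈ {n} {l} |l|≡n k =
  subst (_∈ₗ l) (sym (lookup-toVec n l k)) (nth-∈ (subst (toℕ k <_) (sym |l|≡n) (toℕ<n k)))

toList-All : ∀ {P : ℕ → Set} {n} (v : Vec ℕ n) → (∀ k → P (lookup v k)) → All P (toList v)
toList-All []      _  = []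
toList-All (a ∷ v) Pv = Pv Fin.zero ∷ toList-All v (Pv ∘ Fin.suc)

All-lookup : ∀ {P : ℕ → Set} {n} (v : Vec ℕ n) → All P (toList v) → ∀ k → P (lookup v k)
All-lookup (a ∷ v) (Pa ∷ _)  Fin.zero    = Pa
All-lookup (a ∷ v) (_ ∷ Pv) (Fin.suc k) = All-lookup v Pv k

toList-Pointwise : ∀ {R : ℕ → ℕ → Set} {n} (u v : Vec ℕ n) → (∀ k → R (lookup u k) (lookup v k)) →
                   Pointwise R (toList u) (toList v)
toList-Pointwise []      []      _   = []
toList-Pointwise (a ∷ u) (b ∷ v) Ruv = Ruv Fin.zero ∷ toList-Pointwise u v (Ruv ∘ Fin.suc)

Pointwise-lookup : ∀ {R : ℕ → ℕ → Set} {n} (u v : Vec ℕ n) → Pointwise R (toList u) (toList v) →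
                   ∀ k → R (lookup u k) (lookup v k)
Pointwise-lookup (a ∷ u) (b ∷ v) (Rab ∷ _)   Fin.zero    = Rab
Pointwise-lookup (a ∷ u) (b ∷ v) (_ ∷ Ruv) (Fin.suc k) = Pointwise-lookup u v Ruv k

toList-increasing : ∀ {n} (v : Vec ℕ n) → StrictlyIncreasing v → AllPairs _<_ (toList v)
toList-increasing []      _  = []
toList-increasing (a ∷ v) v↗ =
  toList-All v (λ k → v↗ Fin.zero (Fin.suc k) (s≤s z≤n)) ∷
  toList-increasing v (λ k l k<l → v↗ (Fin.suc k) (Fin.suc l) (s≤s k<l))

increasing-∷ : ∀ {n a} {v : Vec ℕ n} → (∀ k → a < lookup v k) → StrictlyIncreasing v → StrictlyIncreasing (a ∷ v)
increasing-∷ a<v v↗ Fin.zero    (Fin.suc l) _         = a<v l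
increasing-∷ a<v v↗ (Fin.suc k) (Fin.suc l) (s≤s k<l) = v↗ k l k<l

increasing-toList : ∀ {n} (v : Vec ℕ n) → AllPairs _<_ (toList v) → StrictlyIncreasing v
increasing-toList (a ∷ v) (a<v ∷ v↗) = increasing-∷ (All-lookup v a<v) (increasing-toList v v↗)

IsRow : (m : ℕ) → Vec ℕ m → Set
IsRow m y = StrictlyIncreasing y × ((k : Fin m) → InInterval 0 (m + m) (lookup y k))

toList-increasingIn : ∀ {m} (y : Vec ℕ m) → IsRow m y → IncreasingIn (m + m) (toList y)
toList-increasingIn y (y↗ , y∈) = toList-increasing y y↗ , toList-All y y∈

toVec-isRow : ∀ {m l} → IncreasingIn (m + m) l → length l ≡ m → IsRow m (toVec m l)
toVec-isRow {m} {l} (l↗ , l∈) |l|≡m =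
  increasing-toList (toVec m l) (subst (AllPairs _<_) (sym l≡) l↗) , All-lookup (toVec m l) (subst (All _) (sym l≡) l∈)
  where l≡ = toList-toVec m l |l|≡m

-- The y-sequence of T^M(S)

YGo-≥ : ∀ {n} i l (S : Vec Bool n) → l ≤ i → ∀ k → l + i ≤ lookup (YGo i l S) k
YGo-≥ i l (true  ∷ S) l≤i Fin.zero    = ≤-refl
YGo-≥ i l (true  ∷ S) l≤i (Fin.suc k) = ≤-trans (+-monoʳ-≤ l (n≤1+n i)) (YGo-≥ (suc i) l S (m≤n⇒m≤1+n l≤i) k)
YGo-≥ i l (false ∷ S) l≤i Fin.zero    = ≤-trans (+-monoˡ-≤ i l≤i) (≤-reflexive (sym (2*n≡n+n i)))
YGo-≥ i l (false ∷ S) l≤i (Fin.suc k) =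
  ≤-trans (+-monoˡ-≤ i l≤i) (≤-trans (+-monoʳ-≤ i (n≤1+n i)) (YGo-≥ (suc i) i S (n≤1+n i) k))

YGo-≤ : ∀ {n} i l (S : Vec Bool n) → l ≤ i → ∀ k → lookup (YGo i l S) k ≤ 2 * (i + toℕ k)
YGo-≤ i l (true  ∷ S) l≤i Fin.zero    =
  ≤-trans (+-monoˡ-≤ i l≤i) (≤-reflexive (trans (sym (2*n≡n+n i)) (cong (2 *_) (sym (+-identityʳ i)))))
YGo-≤ i l (true  ∷ S) l≤i (Fin.suc k) =
  ≤-trans (YGo-≤ (suc i) l S (m≤n⇒m≤1+n l≤i) k) (≤-reflexive (cong (2 *_) (sym (+-suc i (toℕ k)))))
YGo-≤ i l (false ∷ S) l≤i Fin.zero    = ≤-reflexive (cong (2 *_) (sym (+-identityʳ i)))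
YGo-≤ i l (false ∷ S) l≤i (Fin.suc k) =
  ≤-trans (YGo-≤ (suc i) i S (n≤1+n i) k) (≤-reflexive (cong (2 *_) (sym (+-suc i (toℕ k)))))

YGo-increasing : ∀ {n} i l (S : Vec Bool n) → l ≤ i → StrictlyIncreasing (YGo i l S)
YGo-increasing i l []          _   = λ ()
YGo-increasing i l (true  ∷ S) l≤i =
  increasing-∷ (λ k → <-≤-trans (+-monoʳ-< l (n<1+n i)) (YGo-≥ (suc i) l S (m≤n⇒m≤1+n l≤i) k))
               (YGo-increasing (suc i) l S (m≤n⇒m≤1+n l≤i))
YGo-increasing i l (false ∷ S) l≤i =
  increasing-∷ (λ k → <-≤-trans (≤-reflexive (trans (cong suc (2*n≡n+n i)) (sym (+-suc i i))))
                                 (YGo-≥ (suc i) i S (n≤1+n i) k))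
               (YGo-increasing (suc i) i S (n≤1+n i))

YGo-∉ : ∀ {n} i l (S : Vec Bool n) k → k ∉ S → lookup (YGo i l S) k ≡ 2 * (i + toℕ k)
YGo-∉ i l (true  ∷ S) Fin.zero    k∉S = contradiction here[] k∉S
YGo-∉ i l (false ∷ S) Fin.zero    k∉S = cong (2 *_) (sym (+-identityʳ i))
YGo-∉ i l (true  ∷ S) (Fin.suc k) k∉S =
  trans (YGo-∉ (suc i) l S k (k∉S ∘ there[])) (cong (2 *_) (sym (+-suc i (toℕ k))))
YGo-∉ i l (false ∷ S) (Fin.suc k) k∉S =
  trans (YGo-∉ (suc i) i S k (k∉S ∘ there[])) (cong (2 *_) (sym (+-suc i (toℕ k))))

YM-isRow : ∀ m S → IsRow m (YM m S)
YM-isRow m S = YGo-increasing 1 0 S z≤n , λ k →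
  YGo-≥ 1 0 S z≤n k , ≤-trans (YGo-≤ 1 0 S z≤n k) (≤-trans (*-monoʳ-≤ 2 (toℕ<n k)) (≤-reflexive (2*n≡n+n m)))

YM-∉ : ∀ m S k → k ∉ S → lookup (YM m S) k ≡ 2 * suc (toℕ k)
YM-∉ m S = YGo-∉ 1 0 S

-- Tableaux and their paths

length-path : ∀ {m} q → PathTo m q → length q ≡ m + m
length-path q (qE , qN) = trans (sym (countE+countN q)) (cong₂ _+_ qE qN)

length-pathOf : ∀ m y → length (pathOf m y) ≡ m + m
length-pathOf m y = trans (cong length (pathOf-steps m y)) (length-steps _ 0 (m + m))

ePositions-pathOf : ∀ {m} y → IsRow m y → ePositions 0 (pathOf m y) ≡ toList y
ePositions-pathOf {m} y y-row =
  trans (cong (ePositions 0) (pathOf-steps m y)) (ePositions-steps-∈ᵇ (m + m) (toList y) (toList-increasingIn y y-row))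

pathOf-isPath : ∀ {m} y → IsRow m y → PathTo m (pathOf m y)
pathOf-isPath {m} y y-row = qE , qN
  where
  q = pathOf m y
  qE : countE q ≡ m
  qE = trans (sym (length-ePositions 0 q)) (trans (cong length (ePositions-pathOf y y-row)) (length-toList y))
  qN : countN q ≡ m
  qN = +-cancelˡ-≡ m _ _ (trans (cong (_+ countN q) (sym qE)) (trans (countE+countN q) (length-pathOf m y)))

nPositions-pathOf : ∀ {m} y x → IsRow m y → IsRow m x → (∀ k l → lookup y k ≢ lookup x l) →
                    nPositions 0 (pathOf m y) ≡ toList x
nPositions-pathOf {m} y x y-row x-row y≢x = trans (cong (nPositions 0) (pathOf-steps m y))
  (nPositions-steps-∈ᵇ (m + m) (toList y) (toList x) (toList-increasingIn y y-row) (toList-increasingIn x x-row)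
     (toList-All x λ l → All¬⇒¬Any (toList-All y λ k eq → y≢x k l (sym eq)))
     (cong₂ _+_ (length-toList y) (length-toList x)))

yRow xRow : (m : ℕ) → List Step → Vec ℕ m
yRow m q = toVec m (ePositions 0 q)
xRow m q = toVec m (nPositions 0 q)

pathOf-yRow : ∀ {m} q → PathTo m q → pathOf m (yRow m q) ≡ q
pathOf-yRow {m} q q-path@(qE , _) = begin
  pathOf m (yRow m q)                                 ≡⟨ pathOf-steps m (yRow m q) ⟩
  steps (_∈ᵇ toList (yRow m q)) 0 (m + m)             ≡⟨ cong (λ l → steps (_∈ᵇ l) 0 (m + m)) toList-yRow ⟩
  steps (_∈ᵇ ePositions 0 q) 0 (m + m)                ≡⟨ cong (steps _ 0) (sym (length-path q q-path)) ⟩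
  steps (_∈ᵇ ePositions 0 q) 0 (length q)             ≡⟨ steps-ePositions _ 0 q (λ _ → ∈ᵇ⇔∈ _) ⟩
  q                                                   ∎
  where
  open ≡-Reasoning
  toList-yRow = toList-toVec m (ePositions 0 q) (trans (length-ePositions 0 q) qE)

yRow-pathOf : ∀ {m} y → IsRow m y → yRow m (pathOf m y) ≡ y
yRow-pathOf {m} y y-row = trans (cong (toVec m) (ePositions-pathOf y y-row)) (toVec-toList y)

xRow-pathOf : ∀ {m} y x → IsRow m y → IsRow m x → (∀ k l → lookup y k ≢ lookup x l) → xRow m (pathOf m y) ≡ x
xRow-pathOf {m} y x y-row x-row y≢x = trans (cong (toVec m) (nPositions-pathOf y x y-row x-row y≢x)) (toVec-toList x)

yRow-isRow : ∀ {m} q → PathTo m q → IsRow m (yRow m q)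
yRow-isRow {m} q q-path@(qE , _) =
  toVec-isRow (subst (λ n → IncreasingIn n (ePositions 0 q)) (length-path q q-path) (ePositions-increasingIn q))
              (trans (length-ePositions 0 q) qE)

xRow-isRow : ∀ {m} q → PathTo m q → IsRow m (xRow m q)
xRow-isRow {m} q q-path@(_ , qN) =
  toVec-isRow (subst (λ n → IncreasingIn n (nPositions 0 q)) (length-path q q-path) (nPositions-increasingIn q))
              (trans (length-nPositions 0 q) qN)

yRow-xRow-disjoint : ∀ {m} q → PathTo m q → ∀ k l → lookup (yRow m q) k ≢ lookup (xRow m q) l
yRow-xRow-disjoint {m} q (qE , qN) k l y≡x = ePositions-nPositions-disjoint 0 q
  (lookup-toVec-∈ (trans (length-ePositions 0 q) qE) k)
  (subst (_∈ₗ nPositions 0 q) (sym y≡x) (lookup-toVec-∈ (trans (length-nPositions 0 q) qN) l))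

yRow-≤ : ∀ {m} q → PathTo m q → ∀ k → lookup (yRow m q) k ≤ m + ix k
yRow-≤ {m} q (qE , qN) k rewrite lookup-toVec m (ePositions 0 q) k =
  subst (λ n → nth (ePositions 0 q) (toℕ k) ≤ n + ix k) qN (nth-ePositions-≤ q (subst (toℕ k <_) (sym qE) (toℕ<n k)))

xRow-<-yRow : ∀ {m} q → PathTo m q → ∀ k → 2 * ix k ≤ lookup (yRow m q) k → lookup (xRow m q) k < lookup (yRow m q) k
xRow-<-yRow {m} q (qE , qN) k rewrite lookup-toVec m (ePositions 0 q) k | lookup-toVec m (nPositions 0 q) k =
  nth-nPositions-< q (subst (toℕ k <_) (sym qE) (toℕ<n k)) (subst (toℕ k <_) (sym qN) (toℕ<n k))

IsBoundedYT : (m : ℕ) → Subset m → Vec ℕ m → Vec ℕ m → Set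
IsBoundedYT m S y x = IsYT m S y x × ((k : Fin m) → lookup (YM m S) k ≤ lookup y k × lookup y k ≤ m + ix k)

module _ (m : ℕ) (S : Subset m) where

  private
    Y = YM m S
    Y-row = YM-isRow m S
    p = pathOf m Y

  ≥YM⇔NeverBelow : ∀ y → IsRow m y → Pointwise _≤_ (toList Y) (toList y) ⇔ NeverBelow (pathOf m y) p
  ≥YM⇔NeverBelow y y-row = subst₂ (λ a b → Pointwise _≤_ a b ⇔ NeverBelow (pathOf m y) p)
    (ePositions-pathOf Y Y-row) (ePositions-pathOf y y-row)
    (ePositions-≥⇔NeverBelow (pathOf m y) p
       (trans (proj₁ (pathOf-isPath y y-row)) (sym (proj₁ (pathOf-isPath Y Y-row))))
       (trans (length-pathOf m y) (sym (length-pathOf m Y))))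

  pathOf-isPathAbove : ∀ y x → IsBoundedYT m S y x → IsPathAbove m p (pathOf m y)
  pathOf-isPathAbove y x ((y↗ , _ , y∈ , _) , bounds) =
    pathOf-isPath y (y↗ , y∈) , to (≥YM⇔NeverBelow y (y↗ , y∈)) (toList-Pointwise Y y (proj₁ ∘ bounds))

  rows-isBoundedYT : ∀ q → IsPathAbove m p q → IsBoundedYT m S (yRow m q) (xRow m q)
  rows-isBoundedYT q (q-path , q≥p) =
    (proj₁ y-row , proj₁ x-row , proj₂ y-row , proj₂ x-row , yRow-xRow-disjoint q q-path , x<y) ,
    λ k → Y≤y k , yRow-≤ q q-path k
    where
    y-row = yRow-isRow q q-path
    x-row = xRow-isRow q q-path
    Y≤y : ∀ k → lookup Y k ≤ lookup (yRow m q) k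
    Y≤y = Pointwise-lookup Y (yRow m q)
            (from (≥YM⇔NeverBelow (yRow m q) y-row) (subst (λ r → NeverBelow r p) (sym (pathOf-yRow q q-path)) q≥p))
    x<y : ∀ k → k ∉ S → lookup (xRow m q) k < lookup (yRow m q) k
    x<y k k∉S = xRow-<-yRow q q-path k (subst (_≤ lookup (yRow m q) k) (YM-∉ m S k k∉S) (Y≤y k))

  rows-pathOf : ∀ y x → IsYT m S y x → (yRow m (pathOf m y) , xRow m (pathOf m y)) ≡ (y , x)
  rows-pathOf y x (y↗ , x↗ , y∈ , x∈ , y≢x , _) =
    cong₂ _,_ (yRow-pathOf y (y↗ , y∈)) (xRow-pathOf y x (y↗ , y∈) (x↗ , x∈) y≢x)

  boundedYT↔pathsAbove : BoundedYT m S ↔ PathsAbove m S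
  boundedYT↔pathsAbove = mk↔ₛ′
    (λ { ((y , x) , [ yx-bounded ]) → pathOf m y , [ pathOf-isPathAbove y x yx-bounded ] })
    (λ { (q , [ q-above ]) → (yRow m q , xRow m q) , [ rows-isBoundedYT q q-above ] })
    (λ { (q , [ q-above ]) → value-injective
           (recompute (List.≡-dec _≟ₛ_ _ q) (pathOf-yRow q (proj₁ q-above))) })
    (λ { ((y , x) , [ yx-bounded ]) → value-injective
           (recompute (×-≡-dec (Vec.≡-dec _≟_) (Vec.≡-dec _≟_) _ (y , x)) (rows-pathOf y x (proj₁ yx-bounded))) })

proposition2p3 : (m : ℕ) → 1 ≤ m → (S : Subset m) →
    (BoundedYT m S ↔ PathsAbove m S) × (PathsAbove m S ↔ NuSeqs m S)
-- Both bijections exist for every m.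
proposition2p3 m _ S = boundedYT↔pathsAbove m S , pathsAbove↔seqsBelowMu (pathOf-isPath (YM m S) (YM-isRow m S))
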